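{- Let $q$ be an odd prime power with $q \equiv 1 \pmod 4$. Let $i, j \in F_q^{\ast}$ and let $X, Y \in F_q^2$ be distinct points with $Q(X,Y) = 0$. Then there exists $Z \in F_q^2$ with $Q(X,Z) = i$ and $Q(Y,Z) = j$ if and only if $i \neq j$; furthermore, if $i \neq j$ there is exactly one such point $Z$.
   Context: $F_q$ is the finite field with $q$ elements; the quadrance of $[x_1,y_1],[x_2,y_2] \in F_q^2$ is $Q = (x_2-x_1)^2 + (y_2-y_1)^2$. -}

module Defs where

open import Level using (_⊔_)
open import Algebra.Bundles using (CommutativeRing)
open import Data.Nat using (ℕ; suc; _^_)
open import Data.Nat.Primality using (Prime)
open import Data.Fin using (Fin)
open import Data.Product using (Σ; ∃; _×_; _,_)
open import Relation.Nullary using (¬_)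
open import Relation.Binary.PropositionalEquality using (_≡_)

IsPrimePower : ℕ → Set
IsPrimePower q = Σ ℕ λ p → Σ ℕ λ k → Prime p × q ≡ p ^ suc k

record IsFiniteFieldOfOrder {c ℓ} (F : CommutativeRing c ℓ) (q : ℕ) : Set (c ⊔ ℓ) where
  open CommutativeRing F
  field
    0≉1      : ¬ (0# ≈ 1#)
    inverse  : ∀ x → ¬ (x ≈ 0#) → ∃ λ y → x * y ≈ 1#
    enum     : Fin q → Carrier
    enum-inj : ∀ a b → enum a ≈ enum b → a ≡ b
    enum-sur : ∀ x → ∃ λ a → enum a ≈ x

module _ {c ℓ} (F : CommutativeRing c ℓ) where
  open CommutativeRing F

  Point : Set c
  Point = Carrier × Carrier

  _≈ₚ_ : Point → Point → Set ℓ
  (x₁ , y₁) ≈ₚ (x₂ , y₂) = (x₁ ≈ x₂) × (y₁ ≈ y₂)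

  Q : Point → Point → Carrier
  Q (x₁ , y₁) (x₂ , y₂) = ((x₂ - x₁) * (x₂ - x₁)) + ((y₂ - y₁) * (y₂ - y₁))

-- In odd characteristic, Q X Y ≈ 0 with X ≉ Y forces Y - X = (a , e a) with
-- e² = -1.  In the null coordinates ℓ⁺ = x + e y and ℓ⁻ = x - e y the quadrance
-- factors as Q P R = (ℓ⁺ R - ℓ⁺ P) (ℓ⁻ R - ℓ⁻ P), and ℓ⁺ X = ℓ⁺ Y.  With s, t the
-- null coordinates of Z relative to X and d = ℓ⁻ Y - ℓ⁻ X ≉ 0, the two conditions
-- read s t = i and s (t - d) = j, i.e. s t = i and s d = i - j: for i ≉ 0 this
-- has no solution when i = j and exactly one otherwise.  That 2 ≉ 0 follows from
-- q being odd, since in characteristic 2 the map x ↦ x + 1 pairs up the field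
-- elements.
module Submission where

open import Algebra.Bundles using (CommutativeRing)
import Algebra.Definitions as AlgebraDefinitions
open import Algebra.Solver.Ring.AlmostCommutativeRing using (fromCommutativeRing; _-Raw-AlmostCommutative⟶_)
open import Data.Empty using (⊥-elim)
open import Data.Fin.Base using (Fin; zero; suc; punchIn; punchOut)
open import Data.Fin.Properties using (suc-injective; 0≢1+n; punchIn-injective; punchInᵢ≢i; punchIn-punchOut)
open import Data.Integer.Base as ℤ using (ℤ; +_; -[1+_]; _⊖_)
open import Data.Integer.Properties using (_≟_; [1+m]⊖[1+n]≡m⊖n; pos-*; neg-distribˡ-*; neg-distribʳ-*)
open import Data.Maybe.Base as Maybe using (Maybe)
open import Data.Nat.Base as ℕ using (ℕ; zero; suc; _%_)
open import Data.Nat.Divisibility using (_∣_; _∣0; ∣-refl; ∣m∣n⇒∣m+n; n∣m⇒m%n≡0)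
open import Data.Nat.Properties using (+-suc) renaming (0≢1+n to 0≢1+nℕ)
open import Data.Product using (∃; ∃₂; _×_; _,_; proj₁; proj₂; map₂)
open import Defs
open import Function.Base using (_∘_)
open import Function.Bundles using (_⇔_; mk⇔)
open import Relation.Binary.Bundles using (Setoid)
open import Relation.Binary.Consequences using (dec⇒weaklyDec)
open import Relation.Binary.PropositionalEquality as ≡ using (_≡_; _≢_; module ≡-Reasoning)
open import Relation.Nullary using (¬_)

open AlgebraDefinitions using (Involutive)

-- σ restricted to the complement of its orbit {zero , suc p}, reindexed by Fin m.
module Restriction {m} {σ : Fin (suc (suc m)) → Fin (suc (suc m))}
  (σ-involutive : Involutive _≡_ σ) {p : Fin (suc m)} (σ0≡1+p : σ zero ≡ suc p) where

  open ≡ using (cong; sym; trans)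

  embed : Fin m → Fin (suc (suc m))
  embed a = suc (punchIn p a)

  embed-injective : ∀ {a b} → embed a ≡ embed b → a ≡ b
  embed-injective = punchIn-injective p _ _ ∘ suc-injective

  σ-injective : ∀ {a b} → σ a ≡ σ b → a ≡ b
  σ-injective {a} {b} eq = trans (sym (σ-involutive a)) (trans (cong σ eq) (σ-involutive b))

  σ∘embed≢0 : ∀ a → σ (embed a) ≢ zero
  σ∘embed≢0 a eq = punchInᵢ≢i p a (suc-injective (σ-injective (begin
    σ (embed a)   ≡⟨ eq ⟩
    zero          ≡⟨ σ-involutive zero ⟨
    σ (σ zero)    ≡⟨ cong σ σ0≡1+p ⟩
    σ (suc p)     ∎)))
    where open ≡-Reasoning

  σ∘embed≢1+p : ∀ a → σ (embed a) ≢ suc p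
  σ∘embed≢1+p a eq = 0≢1+n (σ-injective (trans σ0≡1+p (sym eq)))

  unembed : ∀ {b} → b ≢ zero → b ≢ suc p → ∃ λ a → embed a ≡ b
  unembed {zero}  b≢0 _     = ⊥-elim (b≢0 ≡.refl)
  unembed {suc b} _   b≢1+p = punchOut p≢b , cong suc (punchIn-punchOut p≢b)
    where
    p≢b : p ≢ b
    p≢b = b≢1+p ∘ cong suc ∘ sym

  restrict : Fin m → Fin m
  restrict a = proj₁ (unembed (σ∘embed≢0 a) (σ∘embed≢1+p a))

  embed∘restrict : ∀ a → embed (restrict a) ≡ σ (embed a)
  embed∘restrict a = proj₂ (unembed (σ∘embed≢0 a) (σ∘embed≢1+p a))

  restrict-involutive : Involutive _≡_ restrict
  restrict-involutive a = embed-injective (begin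
    embed (restrict (restrict a))   ≡⟨ embed∘restrict (restrict a) ⟩
    σ (embed (restrict a))          ≡⟨ cong σ (embed∘restrict a) ⟩
    σ (σ (embed a))                 ≡⟨ σ-involutive (embed a) ⟩
    embed a                         ∎)
    where open ≡-Reasoning

  restrict-fixpointFree : (∀ a → σ a ≢ a) → ∀ a → restrict a ≢ a
  restrict-fixpointFree σ-fixpointFree a eq =
    σ-fixpointFree (embed a) (trans (sym (embed∘restrict a)) (cong embed eq))

fixpointFree-involution⇒2∣n : ∀ n {σ : Fin n → Fin n} →
  Involutive _≡_ σ → (∀ a → σ a ≢ a) → 2 ∣ n
fixpointFree-involution⇒2∣n zero _ _ = 2 ∣0
fixpointFree-involution⇒2∣n (suc n) {σ} σ-involutive σ-fixpointFree with σ zero in σ0≡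
... | zero = ⊥-elim (σ-fixpointFree zero σ0≡)
fixpointFree-involution⇒2∣n (suc zero) _ _ | suc ()
fixpointFree-involution⇒2∣n (suc (suc m)) {σ} σ-involutive σ-fixpointFree | suc p =
  ∣m∣n⇒∣m+n ∣-refl (fixpointFree-involution⇒2∣n m restrict-involutive (restrict-fixpointFree σ-fixpointFree))
  where open Restriction {σ = σ} σ-involutive σ0≡

module _ {c ℓ} (S : Setoid c ℓ) where
  open Setoid S
  open AlgebraDefinitions _≈_ using () renaming (Involutive to Involutiveₛ; Congruent₁ to Congruentₛ)

  fixpointFree-involution⇒2∣size : ∀ {n} {enum : Fin n → Carrier} →
    (∀ a b → enum a ≈ enum b → a ≡ b) → (∀ x → ∃ λ a → enum a ≈ x) →
    ∀ {f} → Congruentₛ f → Involutiveₛ f → (∀ x → ¬ f x ≈ x) → 2 ∣ n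
  fixpointFree-involution⇒2∣size {n} {enum} enum-inj enum-sur {f} f-cong f-involutive f-fixpointFree =
    fixpointFree-involution⇒2∣n n σ-involutive σ-fixpointFree
    where
    σ : Fin n → Fin n
    σ a = proj₁ (enum-sur (f (enum a)))

    enum∘σ : ∀ a → enum (σ a) ≈ f (enum a)
    enum∘σ a = proj₂ (enum-sur (f (enum a)))

    σ-involutive : Involutive _≡_ σ
    σ-involutive a = enum-inj _ _ (trans (enum∘σ (σ a)) (trans (f-cong (enum∘σ a)) (f-involutive (enum a))))

    σ-fixpointFree : ∀ a → σ a ≢ a
    σ-fixpointFree a eq = f-fixpointFree (enum a) (trans (sym (enum∘σ a)) (reflexive (≡.cong enum eq)))

-- Coefficients are mapped with the optimised _×_, so that the constants 1, 2, -1
-- of the solver evaluate to 1#, 1# + 1#, - 1# on the nose.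
module IntegerCoefficientSolver {c ℓ} (R : CommutativeRing c ℓ) where
  open CommutativeRing R
  open import Algebra.Properties.Ring ring using (-0#≈0#; -‿involutive; -‿+-comm; -‿distribˡ-*; -‿distribʳ-*)
  open import Algebra.Properties.CommutativeSemigroup +-commutativeSemigroup using (interchange)
  open import Algebra.Properties.Semiring.Mult.TCOptimised semiring using (1+×; ×-cong; ×-homo-+; ×1-homo-*)
    renaming (_×_ to _×ₙ_)
  open import Relation.Binary.Reasoning.Setoid setoid

  fromℤ : ℤ → Carrier
  fromℤ (+ n)      = n ×ₙ 1#
  fromℤ -[1+ n ]   = - (suc n ×ₙ 1#)

  fromℤ-⊖ : ∀ m n → fromℤ (m ⊖ n) ≈ m ×ₙ 1# - n ×ₙ 1#
  fromℤ-⊖ m       zero    = sym (trans (+-congˡ -0#≈0#) (+-identityʳ _))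
  fromℤ-⊖ zero    (suc n) = sym (+-identityˡ _)
  fromℤ-⊖ (suc m) (suc n) rewrite [1+m]⊖[1+n]≡m⊖n m n = begin
    fromℤ (m ⊖ n)                  ≈⟨ fromℤ-⊖ m n ⟩
    a - b                          ≈⟨ +-identityˡ (a - b) ⟨
    0# + (a - b)                   ≈⟨ +-congʳ (-‿inverseʳ 1#) ⟨
    (1# - 1#) + (a - b)            ≈⟨ interchange 1# (- 1#) a (- b) ⟩
    (1# + a) + (- 1# - b)          ≈⟨ +-congˡ (-‿+-comm 1# b) ⟩
    (1# + a) - (1# + b)            ≈⟨ +-cong (1+× m 1#) (-‿cong (1+× n 1#)) ⟨
    suc m ×ₙ 1# - suc n ×ₙ 1#      ∎
    where
    a b : Carrier
    a = m ×ₙ 1#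
    b = n ×ₙ 1#

  fromℤ-homo-neg : ∀ x → fromℤ (ℤ.- x) ≈ - fromℤ x
  fromℤ-homo-neg (+ zero)  = sym -0#≈0#
  fromℤ-homo-neg (+ suc n) = refl
  fromℤ-homo-neg -[1+ n ]  = sym (-‿involutive _)

  fromℤ-homo-+ : ∀ x y → fromℤ (x ℤ.+ y) ≈ fromℤ x + fromℤ y
  fromℤ-homo-+ (+ m)    (+ n)    = ×-homo-+ 1# m n
  fromℤ-homo-+ (+ m)    -[1+ n ] = fromℤ-⊖ m (suc n)
  fromℤ-homo-+ -[1+ m ] (+ n)    = trans (fromℤ-⊖ n (suc m)) (+-comm _ _)
  fromℤ-homo-+ -[1+ m ] -[1+ n ] = begin
    - (suc (suc (m ℕ.+ n)) ×ₙ 1#)     ≈⟨ -‿cong (×-cong (≡.cong suc (+-suc m n)) refl) ⟨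
    - ((suc m ℕ.+ suc n) ×ₙ 1#)       ≈⟨ -‿cong (×-homo-+ 1# (suc m) (suc n)) ⟩
    - (suc m ×ₙ 1# + suc n ×ₙ 1#)     ≈⟨ -‿+-comm _ _ ⟨
    - (suc m ×ₙ 1#) - (suc n ×ₙ 1#)   ∎

  fromℤ-homo-*-+ : ∀ m n → fromℤ (+ m ℤ.* + n) ≈ fromℤ (+ m) * fromℤ (+ n)
  fromℤ-homo-*-+ m n rewrite ≡.sym (pos-* m n) = ×1-homo-* m n

  fromℤ-homo-* : ∀ x y → fromℤ (x ℤ.* y) ≈ fromℤ x * fromℤ y
  fromℤ-homo-* (+ m)    (+ n)    = fromℤ-homo-*-+ m n
  fromℤ-homo-* (+ m)    -[1+ n ] = begin
    fromℤ (+ m ℤ.* ℤ.- + suc n)        ≡⟨ ≡.cong fromℤ (neg-distribʳ-* (+ m) (+ suc n)) ⟨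
    fromℤ (ℤ.- (+ m ℤ.* + suc n))      ≈⟨ fromℤ-homo-neg (+ m ℤ.* + suc n) ⟩
    - fromℤ (+ m ℤ.* + suc n)          ≈⟨ -‿cong (fromℤ-homo-*-+ m (suc n)) ⟩
    - (fromℤ (+ m) * fromℤ (+ suc n))  ≈⟨ -‿distribʳ-* _ _ ⟩
    fromℤ (+ m) * - fromℤ (+ suc n)    ∎
  fromℤ-homo-* -[1+ m ] (+ n)    = begin
    fromℤ (ℤ.- + suc m ℤ.* + n)        ≡⟨ ≡.cong fromℤ (neg-distribˡ-* (+ suc m) (+ n)) ⟨
    fromℤ (ℤ.- (+ suc m ℤ.* + n))      ≈⟨ fromℤ-homo-neg (+ suc m ℤ.* + n) ⟩
    - fromℤ (+ suc m ℤ.* + n)          ≈⟨ -‿cong (fromℤ-homo-*-+ (suc m) n) ⟩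
    - (fromℤ (+ suc m) * fromℤ (+ n))  ≈⟨ -‿distribˡ-* _ _ ⟩
    - fromℤ (+ suc m) * fromℤ (+ n)    ∎
  fromℤ-homo-* -[1+ m ] -[1+ n ] = begin
    fromℤ (+ suc m ℤ.* + suc n)        ≈⟨ fromℤ-homo-*-+ (suc m) (suc n) ⟩
    a * b                              ≈⟨ -‿involutive (a * b) ⟨
    - - (a * b)                        ≈⟨ -‿cong (-‿distribˡ-* a b) ⟩
    - (- a * b)                        ≈⟨ -‿distribʳ-* (- a) b ⟩
    - a * - b                          ∎
    where
    a b : Carrier
    a = fromℤ (+ suc m)
    b = fromℤ (+ suc n)

  fromℤ-homomorphism : ℤ.+-*-rawRing -Raw-AlmostCommutative⟶ fromCommutativeRing R
  fromℤ-homomorphism = record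
    { ⟦_⟧    = fromℤ
    ; +-homo = fromℤ-homo-+
    ; *-homo = fromℤ-homo-*
    ; -‿homo = fromℤ-homo-neg
    ; 0-homo = refl
    ; 1-homo = refl
    }

  fromℤ-weaklyDecidable : ∀ x y → Maybe (fromℤ x ≈ fromℤ y)
  fromℤ-weaklyDecidable x y = Maybe.map (reflexive ∘ ≡.cong fromℤ) (dec⇒weaklyDec _≟_ x y)

  open import Algebra.Solver.Ring ℤ.+-*-rawRing (fromCommutativeRing R) fromℤ-homomorphism fromℤ-weaklyDecidable public
    using (solve; _:=_; _:+_; _:-_; _:*_; :-_; con)

module _ {c ℓ} (F : CommutativeRing c ℓ) where
  open CommutativeRing F
  open import Algebra.Properties.Ring ring using (x∙y⁻¹≈ε⇒x≈y; x≈y⇒x∙y⁻¹≈ε; xyx⁻¹≈y; +-cancelˡ; +-cancelʳ)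
  open import Relation.Binary.Reasoning.Setoid setoid
  open IntegerCoefficientSolver F

  x+y*z≈x : ∀ {z} → z ≈ 0# → ∀ x y → x + y * z ≈ x
  x+y*z≈x {z} z≈0 x y = begin
    x + y * z    ≈⟨ +-congˡ (*-congˡ z≈0) ⟩
    x + y * 0#   ≈⟨ +-congˡ (zeroʳ y) ⟩
    x + 0#       ≈⟨ +-identityʳ x ⟩
    x            ∎

  module _ {q : ℕ} (F-field : IsFiniteFieldOfOrder F q) where
    open IsFiniteFieldOfOrder F-field

    characteristic-2⇒2∣order : 1# + 1# ≈ 0# → 2 ∣ q
    characteristic-2⇒2∣order 1+1≈0 =
      fixpointFree-involution⇒2∣size setoid enum-inj enum-sur +-congʳ +1-involutive +1-fixpointFree
      where
      +1-involutive : ∀ x → x + 1# + 1# ≈ x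
      +1-involutive x = begin
        x + 1# + 1#     ≈⟨ +-assoc x 1# 1# ⟩
        x + (1# + 1#)   ≈⟨ +-congˡ 1+1≈0 ⟩
        x + 0#          ≈⟨ +-identityʳ x ⟩
        x               ∎

      +1-fixpointFree : ∀ x → ¬ x + 1# ≈ x
      +1-fixpointFree x x+1≈x = 0≉1 (sym (+-cancelˡ x 1# 0# (trans x+1≈x (sym (+-identityʳ x)))))

    odd-order⇒2≉0 : q % 2 ≡ 1 → ¬ 1# + 1# ≈ 0#
    odd-order⇒2≉0 q%2≡1 1+1≈0 =
      0≢1+nℕ (≡.trans (≡.sym (n∣m⇒m%n≡0 q 2 (characteristic-2⇒2∣order 1+1≈0))) q%2≡1)

  module NullCoordinates (e : Carrier) where

    ℓ⁺ ℓ⁻ : Point F → Carrier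
    ℓ⁺ (x , y) = x + e * y
    ℓ⁻ (x , y) = x - e * y

    -- Identities that hold only modulo e * e + 1# ≈ 0# (and (1# + 1#) * h ≈ 1# below)
    -- are proved by having the solver write the difference of the two sides as a
    -- combination of these relations, which x+y*z≈x then drops.
    module _ (e²+1≈0 : e * e + 1# ≈ 0#) where

      Q≈ℓ⁺*ℓ⁻ : ∀ P R → Q F P R ≈ (ℓ⁺ R - ℓ⁺ P) * (ℓ⁻ R - ℓ⁻ P)
      Q≈ℓ⁺*ℓ⁻ (x₁ , y₁) (x₂ , y₂) = begin
        (x₂ - x₁) * (x₂ - x₁) + (y₂ - y₁) * (y₂ - y₁)
          ≈⟨ solve 5 (λ x₁ y₁ x₂ y₂ e →
               (x₂ :- x₁) :* (x₂ :- x₁) :+ (y₂ :- y₁) :* (y₂ :- y₁)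
               := (x₂ :+ e :* y₂ :- (x₁ :+ e :* y₁)) :* (x₂ :- e :* y₂ :- (x₁ :- e :* y₁))
                  :+ (y₂ :- y₁) :* (y₂ :- y₁) :* (e :* e :+ con (+ 1)))
               refl x₁ y₁ x₂ y₂ e ⟩
        (ℓ⁺ R - ℓ⁺ P) * (ℓ⁻ R - ℓ⁻ P) + (y₂ - y₁) * (y₂ - y₁) * (e * e + 1#)   ≈⟨ x+y*z≈x e²+1≈0 _ _ ⟩
        (ℓ⁺ R - ℓ⁺ P) * (ℓ⁻ R - ℓ⁻ P)                                          ∎
        where P = (x₁ , y₁); R = (x₂ , y₂)

      ℓ⁺-constant-along-null : ∀ {x₁ y₁ x₂ y₂} → y₂ - y₁ ≈ e * (x₂ - x₁) → ℓ⁺ (x₁ , y₁) ≈ ℓ⁺ (x₂ , y₂)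
      ℓ⁺-constant-along-null {x₁} {y₁} {x₂} {y₂} b≈ea = sym (begin
        x₂ + e * y₂                                                   ≈⟨ solve 5 (λ x₁ y₁ x₂ y₂ e →
          x₂ :+ e :* y₂
          := x₁ :+ e :* y₁ :+ e :* ((y₂ :- y₁) :- e :* (x₂ :- x₁)) :+ (x₂ :- x₁) :* (e :* e :+ con (+ 1)))
          refl x₁ y₁ x₂ y₂ e ⟩
        x₁ + e * y₁ + e * (y₂ - y₁ - e * (x₂ - x₁)) + (x₂ - x₁) * (e * e + 1#)
                                                                      ≈⟨ x+y*z≈x e²+1≈0 _ _ ⟩
        x₁ + e * y₁ + e * (y₂ - y₁ - e * (x₂ - x₁))                   ≈⟨ x+y*z≈x (x≈y⇒x∙y⁻¹≈ε b≈ea) _ _ ⟩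
        x₁ + e * y₁                                                   ∎)

      module _ {h : Carrier} (2h≈1 : (1# + 1#) * h ≈ 1#) where

        2h-1≈0 : (1# + 1#) * h - 1# ≈ 0#
        2h-1≈0 = x≈y⇒x∙y⁻¹≈ε 2h≈1

        fromNull : Carrier → Carrier → Point F
        fromNull s t = h * (s + t) , h * e * (t - s)

        ℓ⁺∘fromNull : ∀ s t → ℓ⁺ (fromNull s t) ≈ s
        ℓ⁺∘fromNull s t = begin
          h * (s + t) + e * (h * e * (t - s))                          ≈⟨ solve 4 (λ s t e h →
            h :* (s :+ t) :+ e :* (h :* e :* (t :- s))
            := s :+ s :* (con (+ 2) :* h :- con (+ 1)) :+ h :* (t :- s) :* (e :* e :+ con (+ 1))) refl s t e h ⟩
          s + s * ((1# + 1#) * h - 1#) + h * (t - s) * (e * e + 1#)  ≈⟨ x+y*z≈x e²+1≈0 _ _ ⟩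
          s + s * ((1# + 1#) * h - 1#)                                ≈⟨ x+y*z≈x 2h-1≈0 s s ⟩
          s                                                           ∎

        ℓ⁻∘fromNull : ∀ s t → ℓ⁻ (fromNull s t) ≈ t
        ℓ⁻∘fromNull s t = begin
          h * (s + t) - e * (h * e * (t - s))                          ≈⟨ solve 4 (λ s t e h →
            h :* (s :+ t) :- e :* (h :* e :* (t :- s))
            := t :+ t :* (con (+ 2) :* h :- con (+ 1)) :+ h :* (s :- t) :* (e :* e :+ con (+ 1))) refl s t e h ⟩
          t + t * ((1# + 1#) * h - 1#) + h * (s - t) * (e * e + 1#)  ≈⟨ x+y*z≈x e²+1≈0 _ _ ⟩
          t + t * ((1# + 1#) * h - 1#)                                ≈⟨ x+y*z≈x 2h-1≈0 t t ⟩
          t                                                           ∎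

        fromNull∘ℓ : ∀ P → _≈ₚ_ F (fromNull (ℓ⁺ P) (ℓ⁻ P)) P
        fromNull∘ℓ (x , y) = (begin
          h * ((x + e * y) + (x - e * y))                 ≈⟨ solve 4 (λ x y e h →
            h :* ((x :+ e :* y) :+ (x :- e :* y)) := x :+ x :* (con (+ 2) :* h :- con (+ 1))) refl x y e h ⟩
          x + x * ((1# + 1#) * h - 1#)                    ≈⟨ x+y*z≈x 2h-1≈0 x x ⟩
          x                                               ∎) , (begin
          h * e * ((x - e * y) - (x + e * y))             ≈⟨ solve 4 (λ x y e h →
            h :* e :* ((x :- e :* y) :- (x :+ e :* y))
            := y :+ y :* (con (+ 2) :* h :- con (+ 1)) :+ (:- (con (+ 2) :* h :* y)) :* (e :* e :+ con (+ 1))) refl x y e h ⟩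
          y + y * ((1# + 1#) * h - 1#) + - ((1# + 1#) * h * y) * (e * e + 1#)
                                                          ≈⟨ x+y*z≈x e²+1≈0 _ _ ⟩
          y + y * ((1# + 1#) * h - 1#)                    ≈⟨ x+y*z≈x 2h-1≈0 y y ⟩
          y                                               ∎)

        ℓ-injective : ∀ {P R} → ℓ⁺ P ≈ ℓ⁺ R → ℓ⁻ P ≈ ℓ⁻ R → _≈ₚ_ F P R
        ℓ-injective {P@(x₁ , y₁)} {R@(x₂ , y₂)} ℓ⁺P≈ℓ⁺R ℓ⁻P≈ℓ⁻R =
          trans (sym (proj₁ (fromNull∘ℓ P))) (trans (*-congˡ (+-cong ℓ⁺P≈ℓ⁺R ℓ⁻P≈ℓ⁻R)) (proj₁ (fromNull∘ℓ R))) ,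
          trans (sym (proj₂ (fromNull∘ℓ P))) (trans (*-congˡ (+-cong ℓ⁻P≈ℓ⁻R (-‿cong ℓ⁺P≈ℓ⁺R))) (proj₂ (fromNull∘ℓ R)))

  module _ (inverse : ∀ x → ¬ x ≈ 0# → ∃ λ y → x * y ≈ 1#) where

    ∃-left-inverse : ∀ {x} → ¬ x ≈ 0# → ∃ λ y → y * x ≈ 1#
    ∃-left-inverse {x} x≉0 = map₂ (trans (*-comm _ x)) (inverse x x≉0)

    *-cancelˡ : ∀ {x y z} → ¬ x ≈ 0# → x * y ≈ x * z → y ≈ z
    *-cancelˡ {x} {y} {z} x≉0 xy≈xz with ∃-left-inverse x≉0
    ... | x⁻¹ , x⁻¹x≈1 = begin
      y                  ≈⟨ *-identityˡ y ⟨
      1# * y             ≈⟨ *-congʳ x⁻¹x≈1 ⟨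
      (x⁻¹ * x) * y      ≈⟨ *-assoc x⁻¹ x y ⟩
      x⁻¹ * (x * y)      ≈⟨ *-congˡ xy≈xz ⟩
      x⁻¹ * (x * z)      ≈⟨ *-assoc x⁻¹ x z ⟨
      (x⁻¹ * x) * z      ≈⟨ *-congʳ x⁻¹x≈1 ⟩
      1# * z             ≈⟨ *-identityˡ z ⟩
      z                  ∎

    *-cancelʳ : ∀ {x y z} → ¬ x ≈ 0# → y * x ≈ z * x → y ≈ z
    *-cancelʳ {x} {y} {z} x≉0 yx≈zx = *-cancelˡ x≉0 (trans (*-comm x y) (trans yx≈zx (*-comm z x)))

    x*y≈0⇒y≈0 : ∀ {x y} → ¬ x ≈ 0# → x * y ≈ 0# → y ≈ 0#
    x*y≈0⇒y≈0 {x} x≉0 xy≈0 = *-cancelˡ x≉0 (trans xy≈0 (sym (zeroʳ x)))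

    ∃-quotient : ∀ {x} → ¬ x ≈ 0# → ∀ y → ∃ λ z → z * x ≈ y
    ∃-quotient {x} x≉0 y with ∃-left-inverse x≉0
    ... | x⁻¹ , x⁻¹x≈1 = y * x⁻¹ , (begin
      y * x⁻¹ * x      ≈⟨ *-assoc y x⁻¹ x ⟩
      y * (x⁻¹ * x)    ≈⟨ *-congˡ x⁻¹x≈1 ⟩
      y * 1#           ≈⟨ *-identityʳ y ⟩
      y                ∎)

    module ProductSystem {d : Carrier} (d≉0 : ¬ d ≈ 0#) (i j : Carrier) where

      Solves : Carrier → Carrier → Set ℓ
      Solves s t = s * t ≈ i × s * (t - d) ≈ j

      solves⇒s*d≈i-j : ∀ {s t} → Solves s t → s * d ≈ i - j
      solves⇒s*d≈i-j {s} {t} (st≈i , s[t-d]≈j) = begin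
        s * d                 ≈⟨ solve 3 (λ s t d → s :* d := s :* t :- s :* (t :- d)) refl s t d ⟩
        s * t - s * (t - d)   ≈⟨ +-cong st≈i (-‿cong s[t-d]≈j) ⟩
        i - j                 ∎

      s*d≈i-j⇒[s≈0⇒i≈j] : ∀ {s} → s * d ≈ i - j → s ≈ 0# → i ≈ j
      s*d≈i-j⇒[s≈0⇒i≈j] {s} sd≈i-j s≈0 = x∙y⁻¹≈ε⇒x≈y i j (begin
        i - j    ≈⟨ sd≈i-j ⟨
        s * d    ≈⟨ *-congʳ s≈0 ⟩
        0# * d   ≈⟨ zeroˡ d ⟩
        0#       ∎)

      solves-cong : ∀ {s s′ t t′} → s ≈ s′ → t ≈ t′ → Solves s t → Solves s′ t′
      solves-cong s≈s′ t≈t′ (st≈i , s[t-d]≈j) =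
        trans (sym (*-cong s≈s′ t≈t′)) st≈i ,
        trans (sym (*-cong s≈s′ (+-congʳ t≈t′))) s[t-d]≈j

      solves⇒distinct : ¬ i ≈ 0# → ∀ {s t} → Solves s t → ¬ i ≈ j
      solves⇒distinct i≉0 {s} {t} sol@(st≈i , _) i≈j = i≉0 (begin
        i        ≈⟨ st≈i ⟨
        s * t    ≈⟨ *-congʳ s≈0 ⟩
        0# * t   ≈⟨ zeroˡ t ⟩
        0#       ∎)
        where
        s≈0 : s ≈ 0#
        s≈0 = *-cancelʳ d≉0 (trans (solves⇒s*d≈i-j sol) (trans (x≈y⇒x∙y⁻¹≈ε i≈j) (sym (zeroˡ d))))

      distinct⇒solvable : ¬ i ≈ j → ∃₂ Solves
      distinct⇒solvable i≉j with ∃-quotient d≉0 (i - j)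
      ... | s , sd≈i-j with ∃-quotient (i≉j ∘ s*d≈i-j⇒[s≈0⇒i≈j] sd≈i-j) i
      ... | t , ts≈i = s , t , st≈i , (begin
        s * (t - d)      ≈⟨ solve 3 (λ s t d → s :* (t :- d) := s :* t :- s :* d) refl s t d ⟩
        s * t - s * d    ≈⟨ +-cong st≈i (-‿cong sd≈i-j) ⟩
        i - (i - j)      ≈⟨ solve 2 (λ i j → i :- (i :- j) := j) refl i j ⟩
        j                ∎)
        where
        st≈i : s * t ≈ i
        st≈i = trans (*-comm s t) ts≈i

      solves-unique : ¬ i ≈ j → ∀ {s s′ t t′} → Solves s t → Solves s′ t′ → s ≈ s′ × t ≈ t′
      solves-unique i≉j {s} {s′} {t} {t′} sol@(st≈i , _) sol′@(s′t′≈i , _) = s≈s′ , t≈t′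
        where
        s≈s′ : s ≈ s′
        s≈s′ = *-cancelʳ d≉0 (trans (solves⇒s*d≈i-j sol) (sym (solves⇒s*d≈i-j sol′)))

        s≉0 : ¬ s ≈ 0#
        s≉0 = i≉j ∘ s*d≈i-j⇒[s≈0⇒i≈j] (solves⇒s*d≈i-j sol)

        t≈t′ : t ≈ t′
        t≈t′ = *-cancelˡ s≉0 (trans st≈i (sym (trans (*-congʳ s≈s′) s′t′≈i)))

    null-direction : ∀ {X Y} → Q F X Y ≈ 0# → ¬ _≈ₚ_ F X Y →
                     ∃ λ e → e * e + 1# ≈ 0# × NullCoordinates.ℓ⁺ e X ≈ NullCoordinates.ℓ⁺ e Y
    null-direction {x₁ , y₁} {x₂ , y₂} Q≈0 X≉Y =
      e , e²+1≈0 , NullCoordinates.ℓ⁺-constant-along-null e e²+1≈0 (sym ea≈b)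
      where
      a b : Carrier
      a = x₂ - x₁
      b = y₂ - y₁

      difference≈0⇒≈ : ∀ {u v} → v - u ≈ 0# → u ≈ v
      difference≈0⇒≈ v-u≈0 = sym (x∙y⁻¹≈ε⇒x≈y _ _ v-u≈0)

      a≉0 : ¬ a ≈ 0#
      a≉0 a≈0 = b≉0 (x*y≈0⇒y≈0 b≉0 bb≈0)
        where
        b≉0 : ¬ b ≈ 0#
        b≉0 b≈0 = X≉Y (difference≈0⇒≈ a≈0 , difference≈0⇒≈ b≈0)

        bb≈0 : b * b ≈ 0#
        bb≈0 = begin
          b * b            ≈⟨ +-identityˡ (b * b) ⟨
          0# + b * b       ≈⟨ +-congʳ (trans (*-congʳ a≈0) (zeroˡ a)) ⟨
          a * a + b * b    ≈⟨ Q≈0 ⟩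
          0#               ∎

      e : Carrier
      e = proj₁ (∃-quotient a≉0 b)

      ea≈b : e * a ≈ b
      ea≈b = proj₂ (∃-quotient a≉0 b)

      e²+1≈0 : e * e + 1# ≈ 0#
      e²+1≈0 = x*y≈0⇒y≈0 a≉0 (x*y≈0⇒y≈0 a≉0 (begin
        a * (a * (e * e + 1#))       ≈⟨ solve 2 (λ a e → a :* (a :* (e :* e :+ con (+ 1)))
                                          := a :* a :+ (e :* a) :* (e :* a)) refl a e ⟩
        a * a + (e * a) * (e * a)    ≈⟨ +-congˡ (*-cong ea≈b ea≈b) ⟩
        a * a + b * b                ≈⟨ Q≈0 ⟩
        0#                           ∎))

    module CircleIntersection {e h : Carrier} (e²+1≈0 : e * e + 1# ≈ 0#) (2h≈1 : (1# + 1#) * h ≈ 1#)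
      {X Y : Point F} (X≉Y : ¬ _≈ₚ_ F X Y) (ℓ⁺X≈ℓ⁺Y : NullCoordinates.ℓ⁺ e X ≈ NullCoordinates.ℓ⁺ e Y)
      (i j : Carrier) where
      open NullCoordinates e

      OnCircles : Point F → Set ℓ
      OnCircles Z = Q F X Z ≈ i × Q F Y Z ≈ j

      d : Carrier
      d = ℓ⁻ Y - ℓ⁻ X

      d≉0 : ¬ d ≈ 0#
      d≉0 d≈0 = X≉Y (ℓ-injective e²+1≈0 2h≈1 ℓ⁺X≈ℓ⁺Y (sym (x∙y⁻¹≈ε⇒x≈y _ _ d≈0)))

      open ProductSystem d≉0 i j

      s t : Point F → Carrier
      s Z = ℓ⁺ Z - ℓ⁺ X
      t Z = ℓ⁻ Z - ℓ⁻ X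

      Q[X,Z]≈s*t : ∀ Z → Q F X Z ≈ s Z * t Z
      Q[X,Z]≈s*t = Q≈ℓ⁺*ℓ⁻ e²+1≈0 X

      Q[Y,Z]≈s*[t-d] : ∀ Z → Q F Y Z ≈ s Z * (t Z - d)
      Q[Y,Z]≈s*[t-d] Z = begin
        Q F Y Z                         ≈⟨ Q≈ℓ⁺*ℓ⁻ e²+1≈0 Y Z ⟩
        (ℓ⁺ Z - ℓ⁺ Y) * (ℓ⁻ Z - ℓ⁻ Y)   ≈⟨ *-cong (+-congˡ (-‿cong (sym ℓ⁺X≈ℓ⁺Y)))
                                             (solve 3 (λ z y x → z :- y := (z :- x) :- (y :- x)) refl (ℓ⁻ Z) (ℓ⁻ Y) (ℓ⁻ X)) ⟩
        s Z * (t Z - d)                 ∎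

      on-circles⇒solves : ∀ {Z} → OnCircles Z → Solves (s Z) (t Z)
      on-circles⇒solves {Z} (Q[X,Z]≈i , Q[Y,Z]≈j) =
        trans (sym (Q[X,Z]≈s*t Z)) Q[X,Z]≈i , trans (sym (Q[Y,Z]≈s*[t-d] Z)) Q[Y,Z]≈j

      solves⇒on-circles : ∀ {Z} → Solves (s Z) (t Z) → OnCircles Z
      solves⇒on-circles {Z} (st≈i , s[t-d]≈j) =
        trans (Q[X,Z]≈s*t Z) st≈i , trans (Q[Y,Z]≈s*[t-d] Z) s[t-d]≈j

      on-circles⇒distinct : ¬ i ≈ 0# → ∃ OnCircles → ¬ i ≈ j
      on-circles⇒distinct i≉0 (_ , on-circles) = solves⇒distinct i≉0 (on-circles⇒solves on-circles)

      distinct⇒unique-on-circles : ¬ i ≈ j → ∃ λ Z → OnCircles Z × (∀ Z′ → OnCircles Z′ → _≈ₚ_ F Z′ Z)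
      distinct⇒unique-on-circles i≉j = Z , Z-on-circles , unique
        where
        solution : ∃₂ Solves
        solution = distinct⇒solvable i≉j

        Z : Point F
        Z = fromNull e²+1≈0 2h≈1 (ℓ⁺ X + proj₁ solution) (ℓ⁻ X + proj₁ (proj₂ solution))

        cancel-base : ∀ {b u v} → v ≈ b + u → v - b ≈ u
        cancel-base {b} {u} v≈b+u = trans (+-congʳ v≈b+u) (xyx⁻¹≈y b u)

        Z-on-circles : OnCircles Z
        Z-on-circles = solves⇒on-circles (solves-cong
          (sym (cancel-base (ℓ⁺∘fromNull e²+1≈0 2h≈1 _ _)))
          (sym (cancel-base (ℓ⁻∘fromNull e²+1≈0 2h≈1 _ _)))
          (proj₂ (proj₂ solution)))

        unique : ∀ Z′ → OnCircles Z′ → _≈ₚ_ F Z′ Z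
        unique Z′ Z′-on-circles = ℓ-injective e²+1≈0 2h≈1
          (+-cancelʳ (- ℓ⁺ X) _ _ (proj₁ same)) (+-cancelʳ (- ℓ⁻ X) _ _ (proj₂ same))
          where
          same : s Z′ ≈ s Z × t Z′ ≈ t Z
          same = solves-unique i≉j (on-circles⇒solves Z′-on-circles) (on-circles⇒solves Z-on-circles)

lemma7 : ∀ {c ℓ} (F : CommutativeRing c ℓ) (q : ℕ) →
    IsFiniteFieldOfOrder F q → IsPrimePower q → q % 2 ≡ 1 → q % 4 ≡ 1 →
    let open CommutativeRing F in
    ∀ (i j : Carrier) → ¬ (i ≈ 0#) → ¬ (j ≈ 0#) →
    ∀ (X Y : Point F) → ¬ (_≈ₚ_ F X Y) → Q F X Y ≈ 0# →
    ((∃ λ Z → (Q F X Z ≈ i) × (Q F Y Z ≈ j)) ⇔ (¬ (i ≈ j)))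
    × (¬ (i ≈ j) →
       ∃ λ Z → ((Q F X Z ≈ i) × (Q F Y Z ≈ j))
         × (∀ Z′ → (Q F X Z′ ≈ i) × (Q F Y Z′ ≈ j) → _≈ₚ_ F Z′ Z))
lemma7 F q F-field _ q-odd _ i j i≉0 _ X Y X≉Y Q[X,Y]≈0 =
  mk⇔ (on-circles⇒distinct i≉0) (map₂ proj₁ ∘ distinct⇒unique-on-circles) , distinct⇒unique-on-circles
  where
  open CommutativeRing F
  open IsFiniteFieldOfOrder F-field using (inverse)

  null : ∃ λ e → e * e + 1# ≈ 0# × NullCoordinates.ℓ⁺ F e X ≈ NullCoordinates.ℓ⁺ F e Y
  null = null-direction F inverse Q[X,Y]≈0 X≉Y

  half : ∃ λ h → (1# + 1#) * h ≈ 1#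
  half = inverse (1# + 1#) (odd-order⇒2≉0 F F-field q-odd)

  open CircleIntersection F inverse (proj₁ (proj₂ null)) (proj₂ half) X≉Y (proj₂ (proj₂ null)) i j
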